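{- Let $k$ be a positive integer and let $G$ be a graph with at least one component isomorphic to $P_3$. Then $G$ is a cograph minimal $(\infty,k)$-polar obstruction if and only if $G \cong P_3 + H$, where $H$ is a cograph satisfying: (1) $H$ is not $(1,k-1)$-polar; (2) $H$ is not a cluster; (3) $H$ is $(\infty,k-1)$-polar; (4) $H$ is $(1,k)$-polar or $(\infty,k-2)$-polar; and (5) for each vertex $v$ of $H$, the graph $H - v$ is either $(1,k-1)$-polar or a $k$-cluster.
   Context: All graphs are finite and simple. A cograph is a graph with no induced subgraph isomorphic to $P_4$. $G+H$ denotes disjoint union; $P_3$ is the path on 3 vertices. A cluster is a disjoint union of complete graphs; a $k$-cluster is a cluster with at most $k$ components. For $s,k \in \mathbb{Z}_{\ge 0}\cup\{\infty\}$, an $(s,k)$-polar partition of $G$ is a partition $(A,B)$ of $V(G)$ (parts may be empty) such that $G[A]$ is a complete multipartite graph with at most $s$ parts and $G[B]$ is a cluster with at most $k$ components; $\infty$ means unbounded. $G$ is $(s,k)$-polar if it has such a partition. A cograph minimal $(s,k)$-polar obstruction is a cograph that is not $(s,k)$-polar but all of whose proper induced subgraphs are $(s,k)$-polar. -}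

module Defs where

open import Data.Nat using (ℕ; zero; suc; _+_; _<_; pred)
open import Data.Fin using (Fin; zero; suc; splitAt; punchIn)
open import Data.Bool using (Bool; true; false)
open import Data.Sum using (_⊎_; inj₁; inj₂)
open import Data.Product using (Σ; _×_; _,_; ∃)
open import Relation.Binary.PropositionalEquality using (_≡_; _≢_; refl)
open import Relation.Nullary using (¬_)
open import Function.Bundles using (_⇔_; _↔_; Inverse)
open import Data.Unit using (⊤)
open import Function.Definitions using (Injective)
open import Function.Base using (_∘_)

record Graph : Set where
  field
    n      : ℕ
    adj    : Fin n → Fin n → Bool
    sym    : ∀ i j → adj i j ≡ adj j i
    irrefl : ∀ i → adj i i ≡ false
open Graph public

record _≅_ (G H : Graph) : Set where
  field
    bij  : Fin (n G) ↔ Fin (n H)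
    pres : ∀ i j → adj G i j ≡ adj H (Inverse.to bij i) (Inverse.to bij j)

-- Induced subgraph along an (intended injective) map of vertices.
Induced : (G : Graph) {m : ℕ} → (Fin m → Fin (n G)) → Graph
Induced G {m} f = record
  { n = m
  ; adj = λ i j → adj G (f i) (f j)
  ; sym = λ i j → sym G (f i) (f j)
  ; irrefl = λ i → irrefl G (f i) }

skip : ∀ {n} → Fin n → Fin (pred n) → Fin n
skip {suc m} v = punchIn v

_─_ : (G : Graph) → Fin (n G) → Graph
G ─ v = Induced G (skip v)

-- Disjoint union G + H (vertices of G first).
private
  uadj : ∀ {a b} → (Fin a → Fin a → Bool) → (Fin b → Fin b → Bool)
       → Fin a ⊎ Fin b → Fin a ⊎ Fin b → Bool
  uadj f g (inj₁ i) (inj₁ j) = f i j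
  uadj f g (inj₂ i) (inj₂ j) = g i j
  uadj f g (inj₁ i) (inj₂ j) = false
  uadj f g (inj₂ i) (inj₁ j) = false

  usym : ∀ {a b} (f : Fin a → Fin a → Bool) (g : Fin b → Fin b → Bool)
       → (∀ i j → f i j ≡ f j i) → (∀ i j → g i j ≡ g j i)
       → ∀ x y → uadj f g x y ≡ uadj f g y x
  usym f g sf sg (inj₁ i) (inj₁ j) = sf i j
  usym f g sf sg (inj₂ i) (inj₂ j) = sg i j
  usym f g sf sg (inj₁ i) (inj₂ j) = refl
  usym f g sf sg (inj₂ i) (inj₁ j) = refl

  uirr : ∀ {a b} (f : Fin a → Fin a → Bool) (g : Fin b → Fin b → Bool)
       → (∀ i → f i i ≡ false) → (∀ i → g i i ≡ false)
       → ∀ x → uadj f g x x ≡ false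
  uirr f g rf rg (inj₁ i) = rf i
  uirr f g rf rg (inj₂ i) = rg i

_⊕_ : Graph → Graph → Graph
G ⊕ H = record
  { n = n G + n H
  ; adj = λ i j → uadj (adj G) (adj H) (splitAt (n G) i) (splitAt (n G) j)
  ; sym = λ i j → usym (adj G) (adj H) (sym G) (sym H) (splitAt (n G) i) (splitAt (n G) j)
  ; irrefl = λ i → uirr (adj G) (adj H) (irrefl G) (irrefl H) (splitAt (n G) i) }

private
  p3 : Fin 3 → Fin 3 → Bool
  p3 zero (suc zero) = true
  p3 (suc zero) zero = true
  p3 (suc zero) (suc (suc zero)) = true
  p3 (suc (suc zero)) (suc zero) = true
  p3 _ _ = false

  p3sym : ∀ i j → p3 i j ≡ p3 j i
  p3sym zero zero = refl
  p3sym zero (suc zero) = refl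
  p3sym zero (suc (suc zero)) = refl
  p3sym (suc zero) zero = refl
  p3sym (suc zero) (suc zero) = refl
  p3sym (suc zero) (suc (suc zero)) = refl
  p3sym (suc (suc zero)) zero = refl
  p3sym (suc (suc zero)) (suc zero) = refl
  p3sym (suc (suc zero)) (suc (suc zero)) = refl

  p3irr : ∀ i → p3 i i ≡ false
  p3irr zero = refl
  p3irr (suc zero) = refl
  p3irr (suc (suc zero)) = refl

  p4 : Fin 4 → Fin 4 → Bool
  p4 zero (suc zero) = true
  p4 (suc zero) zero = true
  p4 (suc zero) (suc (suc zero)) = true
  p4 (suc (suc zero)) (suc zero) = true
  p4 (suc (suc zero)) (suc (suc (suc zero))) = true
  p4 (suc (suc (suc zero))) (suc (suc zero)) = true
  p4 _ _ = false

  p4sym : ∀ i j → p4 i j ≡ p4 j i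
  p4sym zero zero = refl
  p4sym zero (suc zero) = refl
  p4sym zero (suc (suc zero)) = refl
  p4sym zero (suc (suc (suc zero))) = refl
  p4sym (suc zero) zero = refl
  p4sym (suc zero) (suc zero) = refl
  p4sym (suc zero) (suc (suc zero)) = refl
  p4sym (suc zero) (suc (suc (suc zero))) = refl
  p4sym (suc (suc zero)) zero = refl
  p4sym (suc (suc zero)) (suc zero) = refl
  p4sym (suc (suc zero)) (suc (suc zero)) = refl
  p4sym (suc (suc zero)) (suc (suc (suc zero))) = refl
  p4sym (suc (suc (suc zero))) zero = refl
  p4sym (suc (suc (suc zero))) (suc zero) = refl
  p4sym (suc (suc (suc zero))) (suc (suc zero)) = refl
  p4sym (suc (suc (suc zero))) (suc (suc (suc zero))) = refl

  p4irr : ∀ i → p4 i i ≡ false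
  p4irr zero = refl
  p4irr (suc zero) = refl
  p4irr (suc (suc zero)) = refl
  p4irr (suc (suc (suc zero))) = refl

P3 : Graph
P3 = record { n = 3 ; adj = p3 ; sym = p3sym ; irrefl = p3irr }

P4 : Graph
P4 = record { n = 4 ; adj = p4 ; sym = p4sym ; irrefl = p4irr }

Cograph : Graph → Set
Cograph G = (f : Fin 4 → Fin (n G)) → Injective _≡_ _≡_ f → ¬ (Induced G f ≅ P4)

-- G has a component isomorphic to P3: a set of three vertices inducing
-- P3 (hence connected) with no edges leaving it (hence maximal).
HasP3Component : Graph → Set
HasP3Component G =
  Σ (Fin 3 → Fin (n G)) λ f → Injective _≡_ _≡_ f × (Induced G f ≅ P3)
    × (∀ (i : Fin 3) (v : Fin (n G)) → (∀ j → f j ≢ v) → adj G (f i) v ≡ false)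

data ℕ∞ : Set where
  fin : ℕ → ℕ∞
  ∞   : ℕ∞

_<∞_ : ℕ → ℕ∞ → Set
m <∞ fin k = m < k
m <∞ ∞     = ⊤

-- Vertex subsets S ⊆ V(G) as predicates.  Parts / components are
-- encoded by a labelling c with labels < bound (so the number of
-- nonempty parts / components is at most the bound).

CompleteMultipartiteOn : (G : Graph) → (Fin (n G) → Set) → ℕ∞ → Set
CompleteMultipartiteOn G S s =
  Σ (Fin (n G) → ℕ) λ c →
    (∀ v → S v → c v <∞ s) ×
    (∀ u v → S u → S v → u ≢ v → (adj G u v ≡ true ⇔ c u ≢ c v))

ClusterOn : (G : Graph) → (Fin (n G) → Set) → ℕ∞ → Set
ClusterOn G S k =
  Σ (Fin (n G) → ℕ) λ c →
    (∀ v → S v → c v <∞ k) ×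
    (∀ u v → S u → S v → u ≢ v → (adj G u v ≡ true ⇔ c u ≡ c v))

IsCluster : ℕ∞ → Graph → Set
IsCluster k G = ClusterOn G (λ _ → ⊤) k

Polar : ℕ∞ → ℕ∞ → Graph → Set
Polar s k G =
  Σ (Fin (n G) → Bool) λ p →
    CompleteMultipartiteOn G (λ v → p v ≡ true) s ×
    ClusterOn G (λ v → p v ≡ false) k

CographMinObs : ℕ∞ → ℕ∞ → Graph → Set
CographMinObs s k G =
  Cograph G × ¬ Polar s k G ×
  (∀ (m : ℕ) (f : Fin m → Fin (n G)) → Injective _≡_ _≡_ f → m < n G
     → Polar s k (Induced G f))

-- Write G = P3 + H.  The vertices of the P3 have no neighbours in H, so in a polar
-- partition each of them constrains H through its side alone: a vertex of the multipartite
-- side A forces every A-vertex of H into its part, and a vertex of the cluster side B keeps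
-- H out of its clique.  Running through the sides of the P3 (for G and for G − v), of the
-- edge P3 − 0 and of the non-edge P3 − 1 turns "G is not (∞,k)-polar but G − x is" into
-- conditions (1), (3), (4), (5) and shows that H is not a k-cluster; (2) then follows since
-- in a polar cluster the A-side is either independent or inside one component.  Conversely,
-- each G − x is partitioned by gluing an explicit partition of P3 (or P3 − x) to one of H
-- (or H − v), and G is a cograph because P4 is connected.

module Submission where

open import Defs hiding (sym)
open import Data.Nat using (ℕ; zero; suc; _+_; _≤_; _<_; _∸_; z≤n; s≤s; pred; _≟_; _<?_)
open import Data.Nat.Properties
  using (≤-refl; ≤-reflexive; <-≤-trans; <⇒≢; n≮n; n<1+n; n≤1+n; n<1⇒n≡0; m≤m+n; +-monoʳ-<; +-cancelˡ-≡;
         suc-injective; m+[n∸m]≡n; ∸-+-assoc)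
open import Data.Fin using (Fin; _↑ˡ_; _↑ʳ_; splitAt; join; punchIn; punchOut)
  renaming (suc to sucF)
open import Data.Fin.Patterns using (0F; 1F; 2F; 3F)
import Data.Fin.Properties as Finₚ
open import Data.Fin.Permutation using (↔⇒≡; insert)
open import Data.Bool using (Bool; true; false; if_then_else_) renaming (_≟_ to _≟ᵇ_)
open import Data.Bool.Properties using (¬-not)
open import Data.Vec using ([]; _∷_; lookup)
open import Data.Product using (Σ; _×_; _,_; proj₁; proj₂; ∃)
open import Data.Sum using (_⊎_; inj₁; inj₂; [_,_]′)
open import Data.Empty using (⊥-elim)
open import Data.Unit using (⊤; tt)
open import Function.Base using (_∘_; id)
open import Function.Bundles using (_⇔_; _↔_; Inverse; Injection; mk⇔; Equivalence)
open Equivalence using (to; from)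
open import Function.Definitions using (Injective)
open import Function.Properties.Inverse using (↔-refl; ↔-sym; ↔⇒↣)
open import Relation.Nullary using (¬_; Dec; yes; no; ¬?; _×-dec_; _→-dec_)
open import Relation.Nullary.Decidable using (True; toWitness; map′)
open import Relation.Unary using (Decidable)
open import Relation.Binary.PropositionalEquality
  using (_≡_; _≢_; refl; sym; trans; cong; cong₂; subst; ≢-sym)

-- Induced embeddings

infix 4 _↪_

record _↪_ (Y X : Graph) : Set where
  field
    vertex    : Fin (n Y) → Fin (n X)
    injective : Injective _≡_ _≡_ vertex
    preserves : ∀ i j → adj Y i j ≡ adj X (vertex i) (vertex j)
open _↪_

↪-refl : ∀ {X} → X ↪ X
↪-refl = record { vertex = id ; injective = id ; preserves = λ _ _ → refl }

↪-trans : ∀ {Z Y X} → Z ↪ Y → Y ↪ X → Z ↪ X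
↪-trans e ι = record
  { vertex = vertex ι ∘ vertex e
  ; injective = injective e ∘ injective ι
  ; preserves = λ i j → trans (preserves e i j) (preserves ι _ _) }

induced-↪ : ∀ X {m} {f : Fin m → Fin (n X)} → Injective _≡_ _≡_ f → Induced X f ↪ X
induced-↪ X f-inj = record { vertex = _ ; injective = f-inj ; preserves = λ _ _ → refl }

skip-injective : ∀ {m} (v : Fin m) → Injective _≡_ _≡_ (skip v)
skip-injective {suc m} v = Finₚ.punchIn-injective v _ _

─-↪ : ∀ X (v : Fin (n X)) → X ─ v ↪ X
─-↪ X v = induced-↪ X (skip-injective v)

≅⇒↪ : ∀ {G H} → G ≅ H → G ↪ H
≅⇒↪ e = record
  { vertex = Inverse.to (_≅_.bij e) ; injective = Injection.injective (↔⇒↣ (_≅_.bij e)) ; preserves = _≅_.pres e }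

≅-sym : ∀ {G H} → G ≅ H → H ≅ G
≅-sym {G} {H} e = record { bij = ↔-sym bij ; pres = pres′ }
  where
  open _≅_ e
  open Inverse bij using (strictlyInverseˡ) renaming (from to bij⁻¹)
  pres′ : ∀ i j → adj H i j ≡ adj G (bij⁻¹ i) (bij⁻¹ j)
  pres′ i j = sym (trans (pres (bij⁻¹ i) (bij⁻¹ j))
                         (cong₂ (adj H) (strictlyInverseˡ i) (strictlyInverseˡ j)))

false≢true : false ≢ true
false≢true ()

adj-subst : ∀ {C : Set} {b b′ : Bool} → b ≡ b′ → (b ≡ true ⇔ C) → (b′ ≡ true ⇔ C)
adj-subst eq = subst (λ b → b ≡ true ⇔ _) eq

polar-↪ : ∀ {s k Y X} → Y ↪ X → Polar s k X → Polar s k Y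
polar-↪ e (p , (a , a< , a-adj) , (c , c< , c-adj)) =
  p ∘ v ,
  (a ∘ v , (λ i → a< (v i)) ,
    (λ i j pi pj i≢j → adj-subst (sym (preserves e i j)) (a-adj _ _ pi pj (i≢j ∘ injective e)))) ,
  (c ∘ v , (λ i → c< (v i)) ,
    (λ i j pi pj i≢j → adj-subst (sym (preserves e i j)) (c-adj _ _ pi pj (i≢j ∘ injective e))))
  where v = vertex e

cograph⇒¬P4↪ : ∀ {X} → Cograph X → ¬ (P4 ↪ X)
cograph⇒¬P4↪ cX e = cX (vertex e) (injective e) (record { bij = ↔-refl ; pres = λ i j → sym (preserves e i j) })

¬P4↪⇒cograph : ∀ {X} → ¬ (P4 ↪ X) → Cograph X
¬P4↪⇒cograph ¬e f f-inj ι = ¬e (↪-trans (≅⇒↪ (≅-sym ι)) (induced-↪ _ f-inj))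

cograph-↪ : ∀ {Y X} → Y ↪ X → Cograph X → Cograph Y
cograph-↪ e cX = ¬P4↪⇒cograph (λ e′ → cograph⇒¬P4↪ cX (↪-trans e′ e))

-- Disjoint unions

data Summand (a b : ℕ) : Fin (a + b) → Set where
  left  : (i : Fin a) → Summand a b (i ↑ˡ b)
  right : (j : Fin b) → Summand a b (a ↑ʳ j)

summand : ∀ a b (x : Fin (a + b)) → Summand a b x
summand zero    b x        = right x
summand (suc a) b 0F       = left 0F
summand (suc a) b (sucF x) with summand a b x
... | left i  = left (sucF i)
... | right j = right j

↑ˡ≢↑ʳ : ∀ {a b} (i : Fin a) (j : Fin b) → i ↑ˡ b ≢ a ↑ʳ j
↑ˡ≢↑ʳ {a} {b} i j eq with trans (sym (Finₚ.splitAt-↑ˡ a i b)) (trans (cong (splitAt a) eq) (Finₚ.splitAt-↑ʳ a b j))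
... | ()

module _ (G H : Graph) where

  ⊕-adj-ˡˡ : ∀ i j → adj (G ⊕ H) (i ↑ˡ n H) (j ↑ˡ n H) ≡ adj G i j
  ⊕-adj-ˡˡ i j rewrite Finₚ.splitAt-↑ˡ (n G) i (n H) | Finₚ.splitAt-↑ˡ (n G) j (n H) = refl

  ⊕-adj-ʳʳ : ∀ i j → adj (G ⊕ H) (n G ↑ʳ i) (n G ↑ʳ j) ≡ adj H i j
  ⊕-adj-ʳʳ i j rewrite Finₚ.splitAt-↑ʳ (n G) (n H) i | Finₚ.splitAt-↑ʳ (n G) (n H) j = refl

  ⊕-adj-ˡʳ : ∀ i j → adj (G ⊕ H) (i ↑ˡ n H) (n G ↑ʳ j) ≡ false
  ⊕-adj-ˡʳ i j rewrite Finₚ.splitAt-↑ˡ (n G) i (n H) | Finₚ.splitAt-↑ʳ (n G) (n H) j = refl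

  ⊕-adj-ʳˡ : ∀ i j → adj (G ⊕ H) (n G ↑ʳ i) (j ↑ˡ n H) ≡ false
  ⊕-adj-ʳˡ i j rewrite Finₚ.splitAt-↑ʳ (n G) (n H) i | Finₚ.splitAt-↑ˡ (n G) j (n H) = refl

  ↑ˡ-↪ : G ↪ G ⊕ H
  ↑ˡ-↪ = record
    { vertex = _↑ˡ n H ; injective = Finₚ.↑ˡ-injective (n H) _ _ ; preserves = λ i j → sym (⊕-adj-ˡˡ i j) }

  ↑ʳ-↪ : H ↪ G ⊕ H
  ↑ʳ-↪ = record
    { vertex = n G ↑ʳ_ ; injective = Finₚ.↑ʳ-injective (n G) _ _ ; preserves = λ i j → sym (⊕-adj-ʳʳ i j) }

⊕-↪ : ∀ {G′ G H′ H} → G′ ↪ G → H′ ↪ H → G′ ⊕ H′ ↪ G ⊕ H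
⊕-↪ {G′} {G} {H′} {H} e ι = record { vertex = v ; injective = v-injective ; preserves = v-preserves }
  where
  v : Fin (n G′ + n H′) → Fin (n G + n H)
  v x = [ (λ i → vertex e i ↑ˡ n H) , (λ j → n G ↑ʳ vertex ι j) ]′ (splitAt (n G′) x)

  v-ˡ : ∀ i → v (i ↑ˡ n H′) ≡ vertex e i ↑ˡ n H
  v-ˡ i rewrite Finₚ.splitAt-↑ˡ (n G′) i (n H′) = refl

  v-ʳ : ∀ j → v (n G′ ↑ʳ j) ≡ n G ↑ʳ vertex ι j
  v-ʳ j rewrite Finₚ.splitAt-↑ʳ (n G′) (n H′) j = refl

  v-injective : Injective _≡_ _≡_ v
  v-injective {x} {y} eq with summand (n G′) (n H′) x | summand (n G′) (n H′) y
  ... | left i  | left j  =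
    cong (_↑ˡ n H′) (injective e (Finₚ.↑ˡ-injective (n H) _ _ (trans (sym (v-ˡ i)) (trans eq (v-ˡ j)))))
  ... | left i  | right j = ⊥-elim (↑ˡ≢↑ʳ _ _ (trans (sym (v-ˡ i)) (trans eq (v-ʳ j))))
  ... | right i | left j  = ⊥-elim (↑ˡ≢↑ʳ _ _ (trans (sym (v-ˡ j)) (trans (sym eq) (v-ʳ i))))
  ... | right i | right j =
    cong (n G′ ↑ʳ_) (injective ι (Finₚ.↑ʳ-injective (n G) _ _ (trans (sym (v-ʳ i)) (trans eq (v-ʳ j)))))

  v-preserves : ∀ x y → adj (G′ ⊕ H′) x y ≡ adj (G ⊕ H) (v x) (v y)
  v-preserves x y with summand (n G′) (n H′) x | summand (n G′) (n H′) y
  ... | left i  | left j  rewrite v-ˡ i | v-ˡ j =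
    trans (⊕-adj-ˡˡ G′ H′ i j) (trans (preserves e i j) (sym (⊕-adj-ˡˡ G H _ _)))
  ... | left i  | right j rewrite v-ˡ i | v-ʳ j = trans (⊕-adj-ˡʳ G′ H′ i j) (sym (⊕-adj-ˡʳ G H _ _))
  ... | right i | left j  rewrite v-ʳ i | v-ˡ j = trans (⊕-adj-ʳˡ G′ H′ i j) (sym (⊕-adj-ʳˡ G H _ _))
  ... | right i | right j rewrite v-ʳ i | v-ʳ j =
    trans (⊕-adj-ʳʳ G′ H′ i j) (trans (preserves ι i j) (sym (⊕-adj-ʳʳ G H _ _)))

Image : ∀ {a b} → (Fin a → Fin b) → Fin b → Set
Image f x = ∃ λ i → f i ≡ x

↪-factor : ∀ {Y Z X} (e : Y ↪ X) (ι : Z ↪ X) → (∀ i → Image (vertex ι) (vertex e i)) → Y ↪ Z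
↪-factor {Y} {Z} {X} e ι im =
  record { vertex = proj₁ ∘ im ; injective = factor-injective ; preserves = factor-preserves }
  where
  factor-injective : Injective _≡_ _≡_ (proj₁ ∘ im)
  factor-injective {i} {j} eq =
    injective e (trans (sym (proj₂ (im i))) (trans (cong (vertex ι) eq) (proj₂ (im j))))

  factor-preserves : ∀ i j → adj Y i j ≡ adj Z (proj₁ (im i)) (proj₁ (im j))
  factor-preserves i j = trans (preserves e i j)
    (trans (cong₂ (adj X) (sym (proj₂ (im i))) (sym (proj₂ (im j)))) (sym (preserves ι _ _)))

-- P4 is connected, so it cannot leave a vertex set closed under adjacency.
P4-inside : ∀ {Z X} (e : P4 ↪ X) (ι : Z ↪ X) →
  (∀ j y → adj X (vertex ι j) y ≡ true → Image (vertex ι) y) →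
  Image (vertex ι) (vertex e 0F) → ∀ i → Image (vertex ι) (vertex e i)
P4-inside {X = X} e ι closed im₀ = λ where
    0F → im₀
    1F → im₁
    2F → im₂
    3F → step im₂ refl
  where
  step : ∀ {i j} → Image (vertex ι) (vertex e i) → adj P4 i j ≡ true → Image (vertex ι) (vertex e j)
  step {i} {j} (l , eq) ij = closed l _
    (trans (cong (λ x → adj X x (vertex e j)) eq) (trans (sym (preserves e i j)) ij))
  im₁ : Image (vertex ι) (vertex e 1F)
  im₁ = step im₀ refl
  im₂ : Image (vertex ι) (vertex e 2F)
  im₂ = step im₁ refl

module _ (G H : Graph) where

  ⊕-ˡ-closed : ∀ i y → adj (G ⊕ H) (i ↑ˡ n H) y ≡ true → Image (_↑ˡ n H) y
  ⊕-ˡ-closed i y iy with summand (n G) (n H) y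
  ... | left j  = j , refl
  ... | right j = ⊥-elim (false≢true (trans (sym (⊕-adj-ˡʳ G H i j)) iy))

  ⊕-ʳ-closed : ∀ i y → adj (G ⊕ H) (n G ↑ʳ i) y ≡ true → Image (n G ↑ʳ_) y
  ⊕-ʳ-closed i y iy with summand (n G) (n H) y
  ... | left j  = ⊥-elim (false≢true (trans (sym (⊕-adj-ʳˡ G H i j)) iy))
  ... | right j = j , refl

cograph-⊕ : ∀ {G H} → Cograph G → Cograph H → Cograph (G ⊕ H)
cograph-⊕ {G} {H} cG cH = ¬P4↪⇒cograph ¬P4
  where
  ¬P4 : ¬ (P4 ↪ G ⊕ H)
  ¬P4 e with splitAt (n G) (vertex e 0F) in eq
  ... | inj₁ i = cograph⇒¬P4↪ cG
    (↪-factor e (↑ˡ-↪ G H) (P4-inside e (↑ˡ-↪ G H) (⊕-ˡ-closed G H) (i , Finₚ.splitAt⁻¹-↑ˡ eq)))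
  ... | inj₂ j = cograph⇒¬P4↪ cH
    (↪-factor e (↑ʳ-↪ G H) (P4-inside e (↑ʳ-↪ G H) (⊕-ʳ-closed G H) (j , Finₚ.splitAt⁻¹-↑ʳ eq)))

cograph-P3 : Cograph P3
cograph-P3 = ¬P4↪⇒cograph {P3} λ e → n≮n 3 (Finₚ.injective⇒≤ (injective e))

-- Polar partitions

module PolarPartition {s k G} (P : Polar s k G) where

  side : Fin (n G) → Bool
  side = proj₁ P

  part clique : Fin (n G) → ℕ
  part   = proj₁ (proj₁ (proj₂ P))
  clique = proj₁ (proj₂ (proj₂ P))

  InA InB : Fin (n G) → Set
  InA v = side v ≡ true
  InB v = side v ≡ false

  clique-bound : ∀ v → InB v → clique v <∞ k
  clique-bound = proj₁ (proj₂ (proj₂ (proj₂ P)))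

  part-adj : ∀ u v → InA u → InA v → u ≢ v → (adj G u v ≡ true ⇔ part u ≢ part v)
  part-adj = proj₂ (proj₂ (proj₁ (proj₂ P)))

  clique-adj : ∀ u v → InB u → InB v → u ≢ v → (adj G u v ≡ true ⇔ clique u ≡ clique v)
  clique-adj = proj₂ (proj₂ (proj₂ (proj₂ P)))

  module _ {u v} (u∈A : InA u) (v∈A : InA v) (u≢v : u ≢ v) where

    A-adj⇒part≢ : adj G u v ≡ true → part u ≢ part v
    A-adj⇒part≢ = to (part-adj u v u∈A v∈A u≢v)

    A-nonadj⇒part≡ : adj G u v ≡ false → part u ≡ part v
    A-nonadj⇒part≡ uv with part u ≟ part v
    ... | yes eq = eq
    ... | no neq = ⊥-elim (false≢true (trans (sym uv) (from (part-adj u v u∈A v∈A u≢v) neq)))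

    A-part≡⇒nonadj : part u ≡ part v → adj G u v ≡ false
    A-part≡⇒nonadj eq with adj G u v in uv
    ... | true  = ⊥-elim (A-adj⇒part≢ uv eq)
    ... | false = refl

  module _ {u v} (u∈B : InB u) (v∈B : InB v) (u≢v : u ≢ v) where

    B-adj⇒clique≡ : adj G u v ≡ true → clique u ≡ clique v
    B-adj⇒clique≡ = to (clique-adj u v u∈B v∈B u≢v)

    B-nonadj⇒clique≢ : adj G u v ≡ false → clique u ≢ clique v
    B-nonadj⇒clique≢ uv eq = false≢true (trans (sym uv) (from (clique-adj u v u∈B v∈B u≢v) eq))

-- squeeze ℓ closes the gap at the unused label ℓ; its value at ℓ itself is junk.
squeeze : ℕ → ℕ → ℕ
squeeze zero    zero    = zero
squeeze zero    (suc x) = x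
squeeze (suc ℓ) zero    = zero
squeeze (suc ℓ) (suc x) = suc (squeeze ℓ x)

squeeze-injective : ∀ ℓ {x y} → x ≢ ℓ → y ≢ ℓ → squeeze ℓ x ≡ squeeze ℓ y → x ≡ y
squeeze-injective zero    {zero}            x≢ℓ _   _  = ⊥-elim (x≢ℓ refl)
squeeze-injective zero    {suc x} {zero}    _   y≢ℓ _  = ⊥-elim (y≢ℓ refl)
squeeze-injective zero    {suc x} {suc y}   _   _   eq = cong suc eq
squeeze-injective (suc ℓ) {zero}  {zero}    _   _   _  = refl
squeeze-injective (suc ℓ) {suc x} {suc y}   x≢ℓ y≢ℓ eq =
  cong suc (squeeze-injective ℓ (x≢ℓ ∘ cong suc) (y≢ℓ ∘ cong suc) (suc-injective eq))

squeeze-< : ∀ ℓ {x k} → x ≢ ℓ → x < k → ℓ < k → squeeze ℓ x < k ∸ 1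
squeeze-< zero    {zero}                x≢ℓ _         _               = ⊥-elim (x≢ℓ refl)
squeeze-< zero    {suc x} {suc k}       _   (s≤s x<k) _               = x<k
squeeze-< (suc ℓ) {zero}  {suc zero}    _   _         (s≤s ())
squeeze-< (suc ℓ) {zero}  {suc (suc k)} _   _         _               = s≤s z≤n
squeeze-< (suc ℓ) {suc x} {suc (suc k)} x≢ℓ (s≤s x<k) (s≤s ℓ<k)       = s≤s (squeeze-< ℓ (x≢ℓ ∘ cong suc) x<k ℓ<k)
squeeze-< (suc ℓ) {suc x} {suc zero}    _   (s≤s ())  _

polar-independent : ∀ {s k G} (P : Polar s k G) → let open PolarPartition {s} {k} {G} P in
  (∀ u v → InA u → InA v → u ≢ v → adj G u v ≡ false) → Polar (fin 1) k G
polar-independent {G = G} (p , _ , B) independent =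
  p , ((λ _ → 0) , (λ _ _ → s≤s z≤n) , part-adj) , B
  where
  part-adj : ∀ u v → p u ≡ true → p v ≡ true → u ≢ v → (adj G u v ≡ true ⇔ 0 ≢ 0)
  part-adj u v u∈A v∈A u≢v =
    mk⇔ (λ uv → ⊥-elim (false≢true (trans (sym (independent u v u∈A v∈A u≢v)) uv))) (λ 0≢0 → ⊥-elim (0≢0 refl))

polar-avoid : ∀ {s k G} (P : Polar s (fin k) G) {ℓ} → ℓ < k → let open PolarPartition {s} {fin k} {G} P in
  (∀ v → InB v → clique v ≢ ℓ) → Polar s (fin (k ∸ 1)) G
polar-avoid {G = G} (p , A , (c , c< , c-adj)) {ℓ} ℓ<k avoids =
  p , A , (squeeze ℓ ∘ c , (λ v v∈B → squeeze-< ℓ (avoids v v∈B) (c< v v∈B) ℓ<k) , squeezed-adj)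
  where
  squeezed-adj : ∀ u v → p u ≡ false → p v ≡ false → u ≢ v → (adj G u v ≡ true ⇔ squeeze ℓ (c u) ≡ squeeze ℓ (c v))
  squeezed-adj u v u∈B v∈B u≢v = mk⇔
    (cong (squeeze ℓ) ∘ to (c-adj u v u∈B v∈B u≢v))
    (from (c-adj u v u∈B v∈B u≢v) ∘ squeeze-injective ℓ (avoids u u∈B) (avoids v v∈B))

polar-allB⇒cluster : ∀ {s k G} (P : Polar s k G) → (∀ v → PolarPartition.InB {s} {k} {G} P v) → IsCluster k G
polar-allB⇒cluster (_ , _ , (c , c< , c-adj)) allB =
  c , (λ v _ → c< v (allB v)) , (λ u v _ _ → c-adj u v (allB u) (allB v))

cluster⇒polar : ∀ {s k G} → IsCluster k G → Polar s k G
cluster⇒polar (c , c< , c-adj) =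
  (λ _ → false) , ((λ _ → 0) , (λ _ ()) , (λ _ _ ())) , (c , (λ v _ → c< v tt) , (λ u v _ _ → c-adj u v tt tt))

-- Vertices anticomplete to an induced subgraph

adj⇒≢ : ∀ G {u v} → adj G u v ≡ true → u ≢ v
adj⇒≢ G uv refl = false≢true (trans (sym (irrefl G _)) uv)

Anticomplete : ∀ X {m} → (Fin m → Fin (n X)) → Fin (n X) → Set
Anticomplete X f x = ∀ i → f i ≢ x × adj X x (f i) ≡ false

module AnticompleteAnalysis {s k X Y} (P : Polar s (fin k) X) (e : Y ↪ X) where
  open PolarPartition {s} {fin k} {X} P

  private
    PY : Polar s (fin k) Y
    PY = polar-↪ e P

    e-part : ∀ {x} → InA x → Anticomplete X (vertex e) x → ∀ i → InA (vertex e i) → part (vertex e i) ≡ part x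
    e-part x∈A x⊥ i i∈A = A-nonadj⇒part≡ i∈A x∈A (proj₁ (x⊥ i)) (trans (Graph.sym X _ _) (proj₂ (x⊥ i)))

    e-clique : ∀ {x} → InB x → Anticomplete X (vertex e) x → ∀ i → InB (vertex e i) → clique (vertex e i) ≢ clique x
    e-clique x∈B x⊥ i i∈B = B-nonadj⇒clique≢ i∈B x∈B (proj₁ (x⊥ i)) (trans (Graph.sym X _ _) (proj₂ (x⊥ i)))

  anticomplete-A : ∀ {x} → InA x → Anticomplete X (vertex e) x → Polar (fin 1) (fin k) Y
  anticomplete-A x∈A x⊥ = polar-independent {s} {fin k} {Y} PY λ i j i∈A j∈A i≢j →
    trans (preserves e i j)
      (A-part≡⇒nonadj i∈A j∈A (i≢j ∘ injective e) (trans (e-part x∈A x⊥ i i∈A) (sym (e-part x∈A x⊥ j j∈A))))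

  anticomplete-B : ∀ {x} → InB x → Anticomplete X (vertex e) x → Polar s (fin (k ∸ 1)) Y
  anticomplete-B x∈B x⊥ = polar-avoid {s} {k} {Y} PY (clique-bound _ x∈B) (e-clique x∈B x⊥)

  anticomplete-AB : ∀ {x y} → InA x → InB y → Anticomplete X (vertex e) x → Anticomplete X (vertex e) y →
    Polar (fin 1) (fin (k ∸ 1)) Y
  anticomplete-AB x∈A y∈B x⊥ y⊥ =
    polar-avoid {fin 1} {k} {Y} (anticomplete-A x∈A x⊥) (clique-bound _ y∈B) (e-clique y∈B y⊥)

  -- Two adjacent vertices of A lie in different parts, so no vertex of Y can join A.
  anticomplete-A-edge : ∀ {x y} → InA x → InA y → adj X x y ≡ true →
    Anticomplete X (vertex e) x → Anticomplete X (vertex e) y → IsCluster (fin k) Y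
  anticomplete-A-edge x∈A y∈A xy x⊥ y⊥ = polar-allB⇒cluster {s} {fin k} {Y} PY allB
    where
    allB : ∀ i → InB (vertex e i)
    allB i with side (vertex e i) in i∈
    ... | true  = ⊥-elim (A-adj⇒part≢ x∈A y∈A (adj⇒≢ X xy) xy
                    (trans (sym (e-part x∈A x⊥ i i∈)) (e-part y∈A y⊥ i i∈)))
    ... | false = refl

  anticomplete-B-nonedge : ∀ {x y} → InB x → InB y → x ≢ y → adj X x y ≡ false →
    Anticomplete X (vertex e) x → Anticomplete X (vertex e) y → 2 ≤ k × Polar s (fin (k ∸ 2)) Y
  anticomplete-B-nonedge {x} {y} x∈B y∈B x≢y xy x⊥ y⊥ =
    <∸1⇒2≤ ℓ<k∸1 ,
    subst (λ m → Polar s (fin m) Y) (∸-+-assoc k 1 1)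
      (polar-avoid {s} {k ∸ 1} {Y} (anticomplete-B x∈B x⊥) ℓ<k∸1 λ i i∈B →
        e-clique y∈B y⊥ i i∈B ∘ squeeze-injective (clique x) (e-clique x∈B x⊥ i i∈B) y≢x)
    where
    y≢x : clique y ≢ clique x
    y≢x eq = B-nonadj⇒clique≢ x∈B y∈B x≢y xy (sym eq)
    ℓ<k∸1 : squeeze (clique x) (clique y) < k ∸ 1
    ℓ<k∸1 = squeeze-< (clique x) y≢x (clique-bound y y∈B) (clique-bound x x∈B)
    <∸1⇒2≤ : ∀ {m k} → m < k ∸ 1 → 2 ≤ k
    <∸1⇒2≤ {k = suc (suc k)} _ = s≤s (s≤s z≤n)

  edge-anticomplete : ∀ {x y} → adj X x y ≡ true →
    Anticomplete X (vertex e) x → Anticomplete X (vertex e) y → Polar s (fin (k ∸ 1)) Y ⊎ IsCluster (fin k) Y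
  edge-anticomplete {x} {y} xy x⊥ y⊥ with side x in x∈ | side y in y∈
  ... | true  | true  = inj₂ (anticomplete-A-edge x∈ y∈ xy x⊥ y⊥)
  ... | true  | false = inj₁ (anticomplete-B y∈ y⊥)
  ... | false | _     = inj₁ (anticomplete-B x∈ x⊥)

  nonedge-anticomplete : ∀ {x y} → x ≢ y → adj X x y ≡ false →
    Anticomplete X (vertex e) x → Anticomplete X (vertex e) y →
    Polar (fin 1) (fin k) Y ⊎ (2 ≤ k × Polar s (fin (k ∸ 2)) Y)
  nonedge-anticomplete {x} {y} x≢y xy x⊥ y⊥ with side x in x∈ | side y in y∈
  ... | true  | _     = inj₁ (anticomplete-A x∈ x⊥)
  ... | false | true  = inj₁ (anticomplete-A y∈ y⊥)
  ... | false | false = inj₂ (anticomplete-B-nonedge x∈ y∈ x≢y xy x⊥ y⊥)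

  P3-anticomplete : ∀ {x y z} → adj X x y ≡ true → adj X y z ≡ true → adj X x z ≡ false → x ≢ z →
    Anticomplete X (vertex e) x → Anticomplete X (vertex e) y → Anticomplete X (vertex e) z →
    Polar (fin 1) (fin (k ∸ 1)) Y ⊎ IsCluster (fin k) Y
  P3-anticomplete {x} {y} {z} xy yz xz x≢z x⊥ y⊥ z⊥ with side y in y∈ | side x in x∈
  ... | true  | true  = inj₂ (anticomplete-A-edge x∈ y∈ xy x⊥ y⊥)
  ... | true  | false = inj₁ (anticomplete-AB y∈ x∈ y⊥ x⊥)
  ... | false | true  = inj₁ (anticomplete-AB x∈ y∈ x⊥ y⊥)
  ... | false | false with side z in z∈
  ...   | true  = inj₁ (anticomplete-AB z∈ y∈ z⊥ y⊥)
  ...   | false = ⊥-elim (B-nonadj⇒clique≢ x∈ z∈ x≢z xz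
                    (trans (B-adj⇒clique≡ x∈ y∈ (adj⇒≢ X xy) xy) (B-adj⇒clique≡ y∈ z∈ (adj⇒≢ X yz) yz)))

-- Polar clusters

module ClusterPolar {K H} (C : IsCluster ∞ H) (P : Polar ∞ (fin K) H) where
  open PolarPartition {∞} {fin K} {H} P

  private
    d : Fin (n H) → ℕ
    d = proj₁ C

    component-adj : ∀ {w w′} → w ≢ w′ → (adj H w w′ ≡ true ⇔ d w ≡ d w′)
    component-adj = proj₂ (proj₂ C) _ _ tt tt

    -- A complete multipartite graph containing an edge uv is connected through u and v.
    A-in-component : ∀ {u v} → InA u → InA v → adj H u v ≡ true → ∀ w → InA w → d w ≡ d u
    A-in-component {u} {v} u∈A v∈A uv w w∈A with w Finₚ.≟ u
    ... | yes refl = refl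
    ... | no w≢u with adj H w u in wu
    ...   | true  = to (component-adj w≢u) wu
    ...   | false with w Finₚ.≟ v
    ...     | yes refl = ⊥-elim (A-adj⇒part≢ u∈A v∈A (adj⇒≢ H uv) uv (sym (A-nonadj⇒part≡ w∈A u∈A w≢u wu)))
    ...     | no w≢v with adj H w v in wv
    ...       | true  = trans (to (component-adj w≢v) wv)
                              (sym (to (component-adj (adj⇒≢ H uv)) uv))
    ...       | false = ⊥-elim (A-adj⇒part≢ u∈A v∈A (adj⇒≢ H uv) uv
                          (trans (sym (A-nonadj⇒part≡ w∈A u∈A w≢u wu)) (A-nonadj⇒part≡ w∈A v∈A w≢v wv)))

    merge-A : ∀ {u m} ℓ → ℓ < m → K ≤ m → (∀ w → InA w → d w ≡ d u) →
      (∀ w → InB w → (clique w ≡ ℓ ⇔ d w ≡ d u)) → IsCluster (fin m) H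
    merge-A {u} {m} ℓ ℓ<m K≤m A⊆u ℓ∼u = label , label< , label-adj
      where
      label : Fin (n H) → ℕ
      label w = if side w then ℓ else clique w

      label< : ∀ w → ⊤ → label w < m
      label< w _ with side w in w∈
      ... | true  = ℓ<m
      ... | false = <-≤-trans (clique-bound w w∈) K≤m

      A-B : ∀ {w w′} → w ≢ w′ → InA w → InB w′ → (adj H w w′ ≡ true ⇔ ℓ ≡ clique w′)
      A-B {w} {w′} w≢w′ w∈ w′∈ = mk⇔
        (λ ww′ → sym (from (ℓ∼u w′ w′∈) (trans (sym (to (component-adj w≢w′) ww′)) (A⊆u w w∈))))
        (λ eq → from (component-adj w≢w′) (trans (A⊆u w w∈) (sym (to (ℓ∼u w′ w′∈) (sym eq)))))

      label-adj : ∀ w w′ → ⊤ → ⊤ → w ≢ w′ → (adj H w w′ ≡ true ⇔ label w ≡ label w′)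
      label-adj w w′ _ _ w≢w′ with side w in w∈ | side w′ in w′∈
      ... | true  | true  = mk⇔ (λ _ → refl)
                              (λ _ → from (component-adj w≢w′) (trans (A⊆u w w∈) (sym (A⊆u w′ w′∈))))
      ... | true  | false = A-B w≢w′ w∈ w′∈
      ... | false | true  = mk⇔ (λ ww′ → sym (to (A-B (≢-sym w≢w′) w′∈ w∈) (trans (Graph.sym H w′ w) ww′)))
                              (λ eq → trans (Graph.sym H w w′) (from (A-B (≢-sym w≢w′) w′∈ w∈) (sym eq)))
      ... | false | false = clique-adj w w′ w∈ w′∈ w≢w′

    B-component : ∀ {u b} → InB b → d b ≡ d u → ∀ w → InB w → (clique w ≡ clique b ⇔ d w ≡ d u)
    B-component {u} {b} b∈B b∼u w w∈B with w Finₚ.≟ b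
    ... | yes refl = mk⇔ (λ _ → b∼u) (λ _ → refl)
    ... | no w≢b = mk⇔ (λ eq → trans (to (component-adj w≢b) (from (clique-adj w b w∈B b∈B w≢b) eq)) b∼u)
                       (λ eq → to (clique-adj w b w∈B b∈B w≢b) (from (component-adj w≢b) (trans eq (sym b∼u))))

  -- Within the cluster H, the set A is either independent or a clique inside one component.
  cluster-polar : Polar (fin 1) (fin K) H ⊎ IsCluster (fin (suc K)) H
  cluster-polar with Finₚ.any? (λ u → Finₚ.any? λ v →
                       (side u ≟ᵇ true) ×-dec (side v ≟ᵇ true) ×-dec ¬? (u Finₚ.≟ v) ×-dec (adj H u v ≟ᵇ true))
  ... | no ¬A-edge = inj₁ (polar-independent {∞} {fin K} {H} P λ u v u∈A v∈A u≢v →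
                        ¬-not λ uv → ¬A-edge (u , v , u∈A , v∈A , u≢v , uv))
  ... | yes (u , v , u∈A , v∈A , _ , uv) with Finₚ.any? (λ b → (side b ≟ᵇ false) ×-dec (d b ≟ d u))
  ...   | yes (b , b∈B , b∼u) = inj₁ (cluster⇒polar {fin 1} {fin K} {H}
            (merge-A (clique b) (clique-bound b b∈B) ≤-refl (A-in-component u∈A v∈A uv) (B-component b∈B b∼u)))
  ...   | no ¬b = inj₂ (merge-A K (n<1+n K) (n≤1+n K) (A-in-component u∈A v∈A uv)
            λ w w∈B → mk⇔ (λ eq → ⊥-elim (<⇒≢ (clique-bound w w∈B) eq)) (λ eq → ⊥-elim (¬b (w , w∈B , eq))))

open ClusterPolar using (cluster-polar)

-- The labels live on all of X but are constrained only on T, so that partitions of X − w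
-- can be built on X itself.

record PolarOn (s k : ℕ∞) (X : Graph) (T : Fin (n X) → Set) : Set where
  field
    side         : Fin (n X) → Bool
    part clique  : Fin (n X) → ℕ
    part-bound   : ∀ v → T v → side v ≡ true → part v <∞ s
    part-adj     : ∀ u v → T u → T v → side u ≡ true → side v ≡ true → u ≢ v →
                   (adj X u v ≡ true ⇔ part u ≢ part v)
    clique-bound : ∀ v → T v → side v ≡ false → clique v <∞ k
    clique-adj   : ∀ u v → T u → T v → side u ≡ false → side v ≡ false → u ≢ v →
                   (adj X u v ≡ true ⇔ clique u ≡ clique v)
open PolarOn

polar⇒polarOn : ∀ {s k X T} → Polar s k X → PolarOn s k X T
polar⇒polarOn (p , (a , a< , a-adj) , (c , c< , c-adj)) = record
  { side = p ; part = a ; clique = c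
  ; part-bound = λ v _ → a< v ; part-adj = λ u v _ _ → a-adj u v
  ; clique-bound = λ v _ → c< v ; clique-adj = λ u v _ _ → c-adj u v }

polarOn-↪ : ∀ {s k X T Y} → PolarOn s k X T → (e : Y ↪ X) → (∀ i → T (vertex e i)) → Polar s k Y
polarOn-↪ P e T-e =
  side P ∘ v ,
  (part P ∘ v , (λ i → part-bound P (v i) (T-e i)) ,
    (λ i j pi pj i≢j →
      adj-subst (sym (preserves e i j)) (part-adj P _ _ (T-e i) (T-e j) pi pj (i≢j ∘ injective e)))) ,
  (clique P ∘ v , (λ i → clique-bound P (v i) (T-e i)) ,
    (λ i j pi pj i≢j →
      adj-subst (sym (preserves e i j)) (clique-adj P _ _ (T-e i) (T-e j) pi pj (i≢j ∘ injective e))))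
  where v = vertex e

polarOn-⊆ : ∀ {s k X T T′} → (∀ x → T′ x → T x) → PolarOn s k X T → PolarOn s k X T′
polarOn-⊆ T′⊆T P = record
  { side = side P ; part = part P ; clique = clique P
  ; part-bound = λ v → part-bound P v ∘ T′⊆T v
  ; part-adj = λ u v tu tv → part-adj P u v (T′⊆T u tu) (T′⊆T v tv)
  ; clique-bound = λ v → clique-bound P v ∘ T′⊆T v
  ; clique-adj = λ u v tu tv → clique-adj P u v (T′⊆T u tu) (T′⊆T v tv) }

polarOn-≤ : ∀ {s k k′ X T} → k ≤ k′ → PolarOn s (fin k) X T → PolarOn s (fin k′) X T
polarOn-≤ k≤k′ P = record
  { side = side P ; part = part P ; clique = clique P
  ; part-bound = part-bound P ; part-adj = part-adj P
  ; clique-bound = λ v tv sv → <-≤-trans (clique-bound P v tv sv) k≤k′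
  ; clique-adj = clique-adj P }

unskip : ∀ {m} (v : Fin m) {x} → x ≢ v → Fin (pred m)
unskip {suc m} v x≢v = punchOut (x≢v ∘ sym)

skip-unskip : ∀ {m} (v : Fin m) {x} (x≢v : x ≢ v) → skip v (unskip v x≢v) ≡ x
skip-unskip {suc m} v x≢v = Finₚ.punchIn-punchOut (x≢v ∘ sym)

-- Extends a labelling of the vertices of X ─ v to X; the label at v itself is junk.
off : ∀ {m} {A : Set} (v : Fin m) → (Fin (pred m) → A) → A → Fin m → A
off v f junk x with x Finₚ.≟ v
... | yes _   = junk
... | no x≢v = f (unskip v x≢v)

off-const : ∀ {m} {A : Set} (v : Fin m) (a : A) x → off v (λ _ → a) a x ≡ a
off-const v a x with x Finₚ.≟ v
... | yes _ = refl
... | no _  = refl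

polarOn-─ : ∀ {s k X} {v : Fin (n X)} → Polar s k (X ─ v) → PolarOn s k X (_≢ v)
polarOn-─ {X = X} {v} (p , (a , a< , a-adj) , (c , c< , c-adj)) = record
  { side = off v p false ; part = off v a 0 ; clique = off v c 0
  ; part-bound = λ x → bound a a< x
  ; part-adj = λ x y → related {R = λ i j → i ≢ j} a a-adj x y
  ; clique-bound = λ x → bound c c< x
  ; clique-adj = λ x y → related {R = _≡_} c c-adj x y }
  where
  unskip-adj : ∀ {x y} (x≢v : x ≢ v) (y≢v : y ≢ v) → adj (X ─ v) (unskip v x≢v) (unskip v y≢v) ≡ adj X x y
  unskip-adj x≢v y≢v = cong₂ (adj X) (skip-unskip v x≢v) (skip-unskip v y≢v)

  unskip-≢ : ∀ {x y} (x≢v : x ≢ v) (y≢v : y ≢ v) → x ≢ y → unskip v x≢v ≢ unskip v y≢v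
  unskip-≢ x≢v y≢v x≢y eq = x≢y (trans (sym (skip-unskip v x≢v)) (trans (cong (skip v) eq) (skip-unskip v y≢v)))

  bound : ∀ {b : Bool} {t : ℕ∞} (f : Fin (pred (n X)) → ℕ) → (∀ i → p i ≡ b → f i <∞ t) →
    ∀ x → x ≢ v → off v p false x ≡ b → off v f 0 x <∞ t
  bound f f< x x≢v px with x Finₚ.≟ v
  ... | yes x≡v = ⊥-elim (x≢v x≡v)
  ... | no _    = f< _ px

  related : ∀ {b : Bool} {R : ℕ → ℕ → Set} (f : Fin (pred (n X)) → ℕ) →
    (∀ i j → p i ≡ b → p j ≡ b → i ≢ j → (adj (X ─ v) i j ≡ true ⇔ R (f i) (f j))) →
    ∀ x y → x ≢ v → y ≢ v → off v p false x ≡ b → off v p false y ≡ b → x ≢ y →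
    (adj X x y ≡ true ⇔ R (off v f 0 x) (off v f 0 y))
  related f f-adj x y x≢v y≢v px py x≢y with x Finₚ.≟ v | y Finₚ.≟ v
  ... | yes x≡v | _        = ⊥-elim (x≢v x≡v)
  ... | no _     | yes y≡v = ⊥-elim (y≢v y≡v)
  ... | no x≢v′  | no y≢v′ = adj-subst (unskip-adj x≢v′ y≢v′) (f-adj _ _ px py (unskip-≢ x≢v′ y≢v′ x≢y))

⊕-pred : ∀ a {b} → (Fin a → Set) → (Fin b → Set) → Fin (a + b) → Set
⊕-pred a S T x = [ S , T ]′ (splitAt a x)

splitAt-injective : ∀ a {b} {x y : Fin (a + b)} → splitAt a x ≡ splitAt a y → x ≡ y
splitAt-injective a {b} {x} {y} eq =
  trans (sym (Finₚ.join-splitAt a b x)) (trans (cong (join a b) eq) (Finₚ.join-splitAt a b y))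

-- Disjoint union: the B-cliques of H are shifted past those of G, while the A-parts
-- must agree across the union since there are no edges between G and H.
polarOn-⊕ : ∀ {s s′ a b G H S T} (Q : PolarOn s (fin a) G S) (R : PolarOn s′ (fin b) H T) →
  (∀ u v → S u → T v → side Q u ≡ true → side R v ≡ true → part Q u ≡ part R v) →
  PolarOn ∞ (fin (a + b)) (G ⊕ H) (⊕-pred (n G) S T)
polarOn-⊕ {a = a} {b} {G} {H} {S} {T} Q R agree = record
  { side = [ side Q , side R ]′ ∘ splitAt (n G)
  ; part = [ part Q , part R ]′ ∘ splitAt (n G)
  ; clique = [ clique Q , (a +_) ∘ clique R ]′ ∘ splitAt (n G)
  ; part-bound = λ _ _ _ → tt
  ; part-adj = part-adj′
  ; clique-bound = clique-bound′
  ; clique-adj = clique-adj′ }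
  where
  ≢ˡ : ∀ {x y i j} → splitAt (n G) x ≡ inj₁ i → splitAt (n G) y ≡ inj₁ j → x ≢ y → i ≢ j
  ≢ˡ x≡ y≡ x≢y refl = x≢y (splitAt-injective (n G) (trans x≡ (sym y≡)))

  ≢ʳ : ∀ {x y i j} → splitAt (n G) x ≡ inj₂ i → splitAt (n G) y ≡ inj₂ j → x ≢ y → i ≢ j
  ≢ʳ x≡ y≡ x≢y refl = x≢y (splitAt-injective (n G) (trans x≡ (sym y≡)))

  clique-bound′ : ∀ x → ⊕-pred (n G) S T x → [ side Q , side R ]′ (splitAt (n G) x) ≡ false →
    [ clique Q , (a +_) ∘ clique R ]′ (splitAt (n G) x) < a + b
  clique-bound′ x tx sx with splitAt (n G) x
  ... | inj₁ i = <-≤-trans (clique-bound Q i tx sx) (m≤m+n a b)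
  ... | inj₂ j = +-monoʳ-< a (clique-bound R j tx sx)

  part-adj′ : ∀ x y → ⊕-pred (n G) S T x → ⊕-pred (n G) S T y →
    [ side Q , side R ]′ (splitAt (n G) x) ≡ true → [ side Q , side R ]′ (splitAt (n G) y) ≡ true → x ≢ y →
    (adj (G ⊕ H) x y ≡ true ⇔ [ part Q , part R ]′ (splitAt (n G) x) ≢ [ part Q , part R ]′ (splitAt (n G) y))
  part-adj′ x y tx ty sx sy x≢y with splitAt (n G) x in x≡ | splitAt (n G) y in y≡
  ... | inj₁ i | inj₁ j = part-adj Q i j tx ty sx sy (≢ˡ x≡ y≡ x≢y)
  ... | inj₁ i | inj₂ j = mk⇔ (λ ()) (λ ne → ⊥-elim (ne (agree i j tx ty sx sy)))
  ... | inj₂ i | inj₁ j = mk⇔ (λ ()) (λ ne → ⊥-elim (ne (sym (agree j i ty tx sy sx))))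
  ... | inj₂ i | inj₂ j = part-adj R i j tx ty sx sy (≢ʳ x≡ y≡ x≢y)

  shifted-≢ : ∀ {c c′} → c < a → c ≢ a + c′
  shifted-≢ {c′ = c′} c<a = <⇒≢ (<-≤-trans c<a (m≤m+n a c′))

  clique-adj′ : ∀ x y → ⊕-pred (n G) S T x → ⊕-pred (n G) S T y →
    [ side Q , side R ]′ (splitAt (n G) x) ≡ false → [ side Q , side R ]′ (splitAt (n G) y) ≡ false → x ≢ y →
    (adj (G ⊕ H) x y ≡ true ⇔
      [ clique Q , (a +_) ∘ clique R ]′ (splitAt (n G) x) ≡ [ clique Q , (a +_) ∘ clique R ]′ (splitAt (n G) y))
  clique-adj′ x y tx ty sx sy x≢y with splitAt (n G) x in x≡ | splitAt (n G) y in y≡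
  ... | inj₁ i | inj₁ j = clique-adj Q i j tx ty sx sy (≢ˡ x≡ y≡ x≢y)
  ... | inj₁ i | inj₂ j = mk⇔ (λ ()) (λ eq → ⊥-elim (shifted-≢ (clique-bound Q i tx sx) eq))
  ... | inj₂ i | inj₁ j = mk⇔ (λ ()) (λ eq → ⊥-elim (shifted-≢ (clique-bound Q j ty sy) (sym eq)))
  ... | inj₂ i | inj₂ j = mk⇔ (cong (a +_) ∘ to (clique-adj R i j tx ty sx sy (≢ʳ x≡ y≡ x≢y)))
                              (from (clique-adj R i j tx ty sx sy (≢ʳ x≡ y≡ x≢y)) ∘ +-cancelˡ-≡ a _ _)

polarOn-⊕-part₀ : ∀ {s a b G H S T} (Q : PolarOn s (fin a) G S) (R : PolarOn (fin 1) (fin b) H T) →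
  (∀ u → part Q u ≡ 0) → PolarOn ∞ (fin (a + b)) (G ⊕ H) (⊕-pred (n G) S T)
polarOn-⊕-part₀ Q R Q≡0 = polarOn-⊕ Q R λ u v _ tv _ v∈A → trans (Q≡0 u) (sym (n<1⇒n≡0 (part-bound R v tv v∈A)))

polarOn-⊕-Bʳ : ∀ {s s′ a b G H S T} (Q : PolarOn s (fin a) G S) (R : PolarOn s′ (fin b) H T) →
  (∀ v → T v → side R v ≡ false) → PolarOn ∞ (fin (a + b)) (G ⊕ H) (⊕-pred (n G) S T)
polarOn-⊕-Bʳ Q R R∈B = polarOn-⊕ Q R λ _ v _ tv _ v∈A → ⊥-elim (false≢true (trans (sym (R∈B v tv)) v∈A))

_<∞?_ : ∀ m s → Dec (m <∞ s)
m <∞? fin k = m <? k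
m <∞? ∞     = yes tt

_⇔?_ : ∀ {A B : Set} → Dec A → Dec B → Dec (A ⇔ B)
a? ⇔? b? = map′ (λ (f , g) → mk⇔ f g) (λ e → to e , from e) ((a? →-dec b?) ×-dec (b? →-dec a?))

-- Whether a given labelling is a polar partition on T is decidable; the finitely many
-- partitions of P3 used below are checked by evaluation.
module _ (s k : ℕ∞) (X : Graph) {T : Fin (n X) → Set} (T? : Decidable T)
         (side′ : Fin (n X) → Bool) (part′ clique′ : Fin (n X) → ℕ) where

  private
    PolarOnConditions : Set
    PolarOnConditions =
      (∀ v → T v → side′ v ≡ true → part′ v <∞ s) ×
      (∀ u v → T u → T v → side′ u ≡ true → side′ v ≡ true → u ≢ v → (adj X u v ≡ true ⇔ part′ u ≢ part′ v)) ×
      (∀ v → T v → side′ v ≡ false → clique′ v <∞ k) ×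
      (∀ u v → T u → T v → side′ u ≡ false → side′ v ≡ false → u ≢ v → (adj X u v ≡ true ⇔ clique′ u ≡ clique′ v))

    polarOnConditions? : Dec PolarOnConditions
    polarOnConditions? =
      Finₚ.all? (λ v → T? v →-dec (side′ v ≟ᵇ true) →-dec (part′ v <∞? s)) ×-dec
      Finₚ.all? (λ u → Finₚ.all? λ v → T? u →-dec T? v →-dec (side′ u ≟ᵇ true) →-dec
        (side′ v ≟ᵇ true) →-dec ¬? (u Finₚ.≟ v) →-dec
        ((adj X u v ≟ᵇ true) ⇔? ¬? (part′ u ≟ part′ v))) ×-dec
      Finₚ.all? (λ v → T? v →-dec (side′ v ≟ᵇ false) →-dec (clique′ v <∞? k)) ×-dec
      Finₚ.all? (λ u → Finₚ.all? λ v → T? u →-dec T? v →-dec (side′ u ≟ᵇ false) →-dec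
        (side′ v ≟ᵇ false) →-dec ¬? (u Finₚ.≟ v) →-dec
        ((adj X u v ≟ᵇ true) ⇔? (clique′ u ≟ clique′ v)))

  decide-polarOn : True polarOnConditions? → PolarOn s k X T
  decide-polarOn ok with toWitness ok
  ... | part-bound , part-adj , clique-bound , clique-adj = record
    { side = side′ ; part = part′ ; clique = clique′
    ; part-bound = part-bound ; part-adj = part-adj ; clique-bound = clique-bound ; clique-adj = clique-adj }

everywhere : Decidable {A = Fin 3} (λ _ → ⊤)
everywhere _ = yes tt

except : (q : Fin 3) → Decidable (_≢ q)
except q x = ¬? (x Finₚ.≟ q)

P3-endsA : PolarOn ∞ (fin 1) P3 (λ _ → ⊤)
P3-endsA = decide-polarOn ∞ (fin 1) P3 everywhere (lookup (true ∷ false ∷ true ∷ [])) (λ _ → 0) (λ _ → 0) _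

P3-endsA-off₁ : PolarOn ∞ (fin 0) P3 (_≢ 1F)
P3-endsA-off₁ = decide-polarOn ∞ (fin 0) P3 (except 1F) (lookup (true ∷ false ∷ true ∷ [])) (λ _ → 0) (λ _ → 0) _

P3-allA : PolarOn ∞ (fin 0) P3 (λ _ → ⊤)
P3-allA = decide-polarOn ∞ (fin 0) P3 everywhere (λ _ → true) (lookup (0 ∷ 1 ∷ 0 ∷ [])) (λ _ → 0) _

P3-allB-off₀ : PolarOn ∞ (fin 1) P3 (_≢ 0F)
P3-allB-off₀ = decide-polarOn ∞ (fin 1) P3 (except 0F) (λ _ → false) (λ _ → 0) (λ _ → 0) _

P3-allB-off₂ : PolarOn ∞ (fin 1) P3 (_≢ 2F)
P3-allB-off₂ = decide-polarOn ∞ (fin 1) P3 (except 2F) (λ _ → false) (λ _ → 0) (λ _ → 0) _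

P3-endsB-off₁ : PolarOn ∞ (fin 2) P3 (_≢ 1F)
P3-endsB-off₁ = decide-polarOn ∞ (fin 2) P3 (except 1F) (λ _ → false) (λ _ → 0) (lookup (0 ∷ 0 ∷ 1 ∷ [])) _

ProperlyPolar : ℕ∞ → ℕ∞ → Graph → Set
ProperlyPolar s k G =
  ∀ (m : ℕ) (f : Fin m → Fin (n G)) → Injective _≡_ _≡_ f → m < n G → Polar s k (Induced G f)

missed-vertex : ∀ {m N} (f : Fin m → Fin N) → Injective _≡_ _≡_ f → m < N → ∃ λ w → ∀ i → f i ≢ w
missed-vertex {m} {N} f f-inj m<N with Finₚ.all? (λ w → Finₚ.any? λ i → f i Finₚ.≟ w)
... | yes onto = ⊥-elim (n≮n m (<-≤-trans m<N (Finₚ.injective⇒≤ section-injective)))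
  where
  section-injective : Injective _≡_ _≡_ (proj₁ ∘ onto)
  section-injective {w} {w′} eq = trans (sym (proj₂ (onto w))) (trans (cong f eq) (proj₂ (onto w′)))
... | no ¬onto with Finₚ.¬∀⟶∃¬ N _ (λ w → Finₚ.any? λ i → f i Finₚ.≟ w) ¬onto
...   | w , ¬hit = w , λ i fi≡w → ¬hit (i , fi≡w)

deletions⇒properlyPolar : ∀ {s k X} → (∀ w → PolarOn s k X (_≢ w)) → ProperlyPolar s k X
deletions⇒properlyPolar {X = X} P m f f-inj m<n with missed-vertex f f-inj m<n
... | w , f≢w = polarOn-↪ (P w) (induced-↪ X f-inj) f≢w

properlyPolar-↪ : ∀ {s k Y X} → ProperlyPolar s k X → (e : Y ↪ X) → n Y < n X → Polar s k Y
properlyPolar-↪ {Y = Y} {X} PX e lt = polar-↪ Y↪image (PX _ (vertex e) (injective e) lt)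
  where
  Y↪image : Y ↪ Induced X (vertex e)
  Y↪image = record { vertex = id ; injective = id ; preserves = preserves e }

properlyPolar-≅ : ∀ {s k G X} → G ≅ X → ProperlyPolar s k X → ProperlyPolar s k G
properlyPolar-≅ {G = G} e PX m f f-inj m<n =
  properlyPolar-↪ PX (↪-trans (induced-↪ G f-inj) (≅⇒↪ e)) (subst (m <_) (↔⇒≡ (_≅_.bij e)) m<n)

cographMinObs-≅ : ∀ {s k G X} → G ≅ X → CographMinObs s k X → CographMinObs s k G
cographMinObs-≅ e (cograph , ¬polar , properlyPolar) =
  cograph-↪ (≅⇒↪ e) cograph , ¬polar ∘ polar-↪ (≅⇒↪ (≅-sym e)) , properlyPolar-≅ e properlyPolar

-- Splitting off a component

extend-injection : ∀ {a m N} (g : Fin a → Fin N) → Injective _≡_ _≡_ g → a + m ≡ N →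
  Σ (Fin (a + m) ↔ Fin N) λ π → ∀ q → Inverse.to π (q ↑ˡ m) ≡ g q
extend-injection {zero}      g _     refl = ↔-refl , λ ()
extend-injection {suc a} {m} g g-inj refl = insert 0F (g 0F) (proj₁ rest) , extends
  where
  g₀≢ : ∀ q → g 0F ≢ g (sucF q)
  g₀≢ q eq with g-inj eq
  ... | ()

  g′ : Fin a → Fin (a + m)
  g′ q = punchOut (g₀≢ q)

  g′-injective : Injective _≡_ _≡_ g′
  g′-injective {p} {q} eq = Finₚ.suc-injective (g-inj (Finₚ.punchOut-injective (g₀≢ p) (g₀≢ q) eq))

  rest : Σ (Fin (a + m) ↔ Fin (a + m)) λ π → ∀ q → Inverse.to π (q ↑ˡ m) ≡ g′ q
  rest = extend-injection g′ g′-injective refl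

  -- insert 0 (g 0) π sends 0 to g 0 and suc x to punchIn (g 0) (π x).
  extends : ∀ q → Inverse.to (insert 0F (g 0F) (proj₁ rest)) (q ↑ˡ m) ≡ g q
  extends 0F       = refl
  extends (sucF q) = trans (cong (punchIn (g 0F)) (proj₂ rest q)) (Finₚ.punchIn-punchOut (g₀≢ q))

split-≅ : ∀ {X Y} (e : Y ↪ X) → (∀ q v → (∀ q′ → vertex e q′ ≢ v) → adj X (vertex e q) v ≡ false) →
  Σ Graph λ H → X ≅ (Y ⊕ H)
split-≅ {X} {Y} e closed = H , record { bij = ↔-sym π ; pres = π-pres }
  where
  m : ℕ
  m = n X ∸ n Y
  extension : Σ (Fin (n Y + m) ↔ Fin (n X)) λ π → ∀ q → Inverse.to π (q ↑ˡ m) ≡ vertex e q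
  extension = extend-injection {m = m} (vertex e) (injective e) (m+[n∸m]≡n (Finₚ.injective⇒≤ (injective e)))
  π : Fin (n Y + m) ↔ Fin (n X)
  π = proj₁ extension
  σ : Fin (n Y + m) → Fin (n X)
  σ = Inverse.to π
  σ-extends : ∀ q → σ (q ↑ˡ m) ≡ vertex e q
  σ-extends = proj₂ extension

  H : Graph
  H = Induced X (σ ∘ (n Y ↑ʳ_))

  across : ∀ i j → adj X (σ (i ↑ˡ m)) (σ (n Y ↑ʳ j)) ≡ false
  across i j = trans (cong (λ x → adj X x _) (σ-extends i))
    (closed i _ λ q eq → ↑ˡ≢↑ʳ q j (Injection.injective (↔⇒↣ π) (trans (σ-extends q) eq)))

  σ-adj : ∀ x y → adj (Y ⊕ H) x y ≡ adj X (σ x) (σ y)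
  σ-adj x y with summand (n Y) m x | summand (n Y) m y
  ... | left i  | left j  = trans (⊕-adj-ˡˡ Y H i j)
                              (trans (preserves e i j) (cong₂ (adj X) (sym (σ-extends i)) (sym (σ-extends j))))
  ... | left i  | right j = trans (⊕-adj-ˡʳ Y H i j) (sym (across i j))
  ... | right i | left j  = trans (⊕-adj-ʳˡ Y H i j) (sym (trans (Graph.sym X _ _) (across j i)))
  ... | right i | right j = ⊕-adj-ʳʳ Y H i j

  π-pres : ∀ i j → adj X i j ≡ adj (Y ⊕ H) (Inverse.from π i) (Inverse.from π j)
  π-pres i j = sym (trans (σ-adj _ _) (cong₂ (adj X) (Inverse.strictlyInverseˡ π i) (Inverse.strictlyInverseˡ π j)))

P3-component-split : ∀ {G} → HasP3Component G → Σ Graph λ H → G ≅ (P3 ⊕ H)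
P3-component-split {G} (f , f-inj , ι , outside) = split-≅ e closed
  where
  e : P3 ↪ G
  e = ↪-trans (≅⇒↪ (≅-sym ι)) (induced-↪ G f-inj)

  closed : ∀ q v → (∀ q′ → vertex e q′ ≢ v) → adj G (vertex e q) v ≡ false
  closed q v missed = outside _ v λ j fj≡v →
    missed (Inverse.to (_≅_.bij ι) j) (trans (cong f (Inverse.strictlyInverseʳ (_≅_.bij ι) j)) fj≡v)

-- Obstructions with a P3 component

⊕-pred-everywhere : ∀ a {b} x → ⊕-pred a {b} (λ _ → ⊤) (λ _ → ⊤) x
⊕-pred-everywhere a x with splitAt a x
... | inj₁ _ = tt
... | inj₂ _ = tt

⊕-pred-offˡ : ∀ {a b} (q : Fin a) x → x ≢ q ↑ˡ b → ⊕-pred a (_≢ q) (λ _ → ⊤) x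
⊕-pred-offˡ {a} {b} q x x≢q with splitAt a x in eq
... | inj₁ i = λ i≡q → x≢q (trans (sym (Finₚ.splitAt⁻¹-↑ˡ eq)) (cong (_↑ˡ b) i≡q))
... | inj₂ _ = tt

⊕-pred-offʳ : ∀ {a b} (v : Fin b) x → x ≢ a ↑ʳ v → ⊕-pred a (λ _ → ⊤) (_≢ v) x
⊕-pred-offʳ {a} v x x≢v with splitAt a x in eq
... | inj₁ _ = tt
... | inj₂ j = λ j≡v → x≢v (trans (sym (Finₚ.splitAt⁻¹-↑ʳ eq)) (cong (a ↑ʳ_) j≡v))

polarOn-everywhere : ∀ {s k X T} → PolarOn s k X T → (∀ x → T x) → Polar s k X
polarOn-everywhere P T-everywhere = polarOn-↪ P ↪-refl T-everywhere

cluster-∞ : ∀ {k H} → IsCluster k H → IsCluster ∞ H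
cluster-∞ (c , _ , c-adj) = c , (λ _ _ → tt) , c-adj

pred< : ∀ {m} → Fin m → pred m < m
pred< {suc m} _ = ≤-refl

P3ObstructionConditions : ℕ → Graph → Set
P3ObstructionConditions k H =
  ¬ Polar (fin 1) (fin (k ∸ 1)) H
  × ¬ IsCluster ∞ H
  × Polar ∞ (fin (k ∸ 1)) H
  × (Polar (fin 1) (fin k) H ⊎ (2 ≤ k × Polar ∞ (fin (k ∸ 2)) H))
  × (∀ v → Polar (fin 1) (fin (k ∸ 1)) (H ─ v) ⊎ IsCluster (fin k) (H ─ v))

module P3Obstruction {K : ℕ} {H : Graph} where

  obstruction⇒conditions : CographMinObs ∞ (fin (suc K)) (P3 ⊕ H) → Cograph H × P3ObstructionConditions (suc K) H
  obstruction⇒conditions (cograph , ¬polar , properlyPolar) =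
    cograph-↪ (↑ʳ-↪ P3 H) cograph , ¬[1,K]-polar , ¬cluster , [∞,K]-polar , [1,k]⊎[∞,k∸2] , deletions
    where
    ¬[1,K]-polar : ¬ Polar (fin 1) (fin K) H
    ¬[1,K]-polar P = ¬polar (polarOn-everywhere {∞} {fin (suc K)} {P3 ⊕ H}
      (polarOn-⊕-part₀ P3-endsA (polar⇒polarOn P) λ _ → refl)
      (⊕-pred-everywhere 3))

    ¬k-cluster : ¬ IsCluster (fin (suc K)) H
    ¬k-cluster C = ¬polar (polarOn-everywhere {∞} {fin (suc K)} {P3 ⊕ H}
      (polarOn-⊕-Bʳ P3-allA (polar⇒polarOn (cluster⇒polar {∞} {fin (suc K)} {H} C)) λ _ _ → refl)
      (⊕-pred-everywhere 3))

    proper : ∀ {Y} → Y ↪ P3 ⊕ H → n Y < n (P3 ⊕ H) → Polar ∞ (fin (suc K)) Y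
    proper = properlyPolar-↪ {∞} {fin (suc K)} {_} {P3 ⊕ H} properlyPolar

    module Delete₀ = AnticompleteAnalysis {∞} {suc K} {(P3 ─ 0F) ⊕ H}
      (proper (⊕-↪ (─-↪ P3 0F) ↪-refl) ≤-refl) (↑ʳ-↪ _ H)
    module Delete₁ = AnticompleteAnalysis {∞} {suc K} {(P3 ─ 1F) ⊕ H}
      (proper (⊕-↪ (─-↪ P3 1F) ↪-refl) ≤-refl) (↑ʳ-↪ _ H)
    module DeleteH (v : Fin (n H)) = AnticompleteAnalysis {∞} {suc K} {P3 ⊕ (H ─ v)}
      (proper (⊕-↪ ↪-refl (─-↪ H v)) (+-monoʳ-< 3 (pred< v))) (↑ʳ-↪ P3 _)

    [∞,K]-polar : Polar ∞ (fin K) H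
    [∞,K]-polar with Delete₀.edge-anticomplete {0F} {1F} refl (λ _ → (λ ()) , refl) (λ _ → (λ ()) , refl)
    ... | inj₁ P = P
    ... | inj₂ C = ⊥-elim (¬k-cluster C)

    ¬cluster : ¬ IsCluster ∞ H
    ¬cluster C with cluster-polar {K} {H} C [∞,K]-polar
    ... | inj₁ P  = ¬[1,K]-polar P
    ... | inj₂ C′ = ¬k-cluster C′

    [1,k]⊎[∞,k∸2] : Polar (fin 1) (fin (suc K)) H ⊎ (2 ≤ suc K × Polar ∞ (fin (suc K ∸ 2)) H)
    [1,k]⊎[∞,k∸2] = Delete₁.nonedge-anticomplete {0F} {1F} (λ ()) refl (λ _ → (λ ()) , refl) (λ _ → (λ ()) , refl)

    deletions : ∀ v → Polar (fin 1) (fin K) (H ─ v) ⊎ IsCluster (fin (suc K)) (H ─ v)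
    deletions v = DeleteH.P3-anticomplete v {0F} {1F} {2F} refl refl refl (λ ())
      (λ _ → (λ ()) , refl) (λ _ → (λ ()) , refl) (λ _ → (λ ()) , refl)

  without-middle : Polar (fin 1) (fin (suc K)) H ⊎ (2 ≤ suc K × Polar ∞ (fin (suc K ∸ 2)) H) →
    PolarOn ∞ (fin (suc K)) (P3 ⊕ H) (⊕-pred 3 (_≢ 1F) (λ _ → ⊤))
  without-middle (inj₁ P) = polarOn-⊕-part₀ P3-endsA-off₁ (polar⇒polarOn P) λ _ → refl
  without-middle (inj₂ (2≤k , P)) =
    polarOn-≤ (≤-reflexive (m+[n∸m]≡n 2≤k)) (polarOn-⊕ P3-endsB-off₁ (polar⇒polarOn P) λ _ _ _ _ ())

  without-H-vertex : ∀ v → Polar (fin 1) (fin K) (H ─ v) ⊎ IsCluster (fin (suc K)) (H ─ v) →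
    PolarOn ∞ (fin (suc K)) (P3 ⊕ H) (⊕-pred 3 (λ _ → ⊤) (_≢ v))
  without-H-vertex v (inj₁ P) = polarOn-⊕-part₀ P3-endsA (polarOn-─ {fin 1} {fin K} {H} P) λ _ → refl
  without-H-vertex v (inj₂ C) = polarOn-⊕-Bʳ P3-allA
    (polarOn-─ {∞} {fin (suc K)} {H} (cluster⇒polar {∞} {fin (suc K)} {H ─ v} C)) λ x _ → off-const v false x

  deletion-partitions : P3ObstructionConditions (suc K) H → ∀ w → PolarOn ∞ (fin (suc K)) (P3 ⊕ H) (_≢ w)
  deletion-partitions (_ , _ , [∞,K]-polar , [1,k]⊎[∞,k∸2] , deletions) w with summand 3 (n H) w
  ... | left 0F = polarOn-⊆ (⊕-pred-offˡ 0F) (polarOn-⊕ P3-allB-off₀ (polar⇒polarOn [∞,K]-polar) λ _ _ _ _ ())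
  ... | left 1F = polarOn-⊆ (⊕-pred-offˡ 1F) (without-middle [1,k]⊎[∞,k∸2])
  ... | left 2F = polarOn-⊆ (⊕-pred-offˡ 2F) (polarOn-⊕ P3-allB-off₂ (polar⇒polarOn [∞,K]-polar) λ _ _ _ _ ())
  ... | right v = polarOn-⊆ (⊕-pred-offʳ v) (without-H-vertex v (deletions v))

  conditions⇒obstruction : Cograph H → P3ObstructionConditions (suc K) H → CographMinObs ∞ (fin (suc K)) (P3 ⊕ H)
  conditions⇒obstruction cograph conditions@(¬[1,K]-polar , ¬cluster , _) =
    cograph-⊕ cograph-P3 cograph , ¬polar , deletions⇒properlyPolar (deletion-partitions conditions)
    where
    ¬polar : ¬ Polar ∞ (fin (suc K)) (P3 ⊕ H)
    ¬polar P with AnticompleteAnalysis.P3-anticomplete {∞} {suc K} {P3 ⊕ H} P (↑ʳ-↪ P3 H)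
                    {0F} {1F} {2F} refl refl refl (λ ())
                    (λ _ → (λ ()) , refl) (λ _ → (λ ()) , refl) (λ _ → (λ ()) , refl)
    ... | inj₁ P′ = ¬[1,K]-polar P′
    ... | inj₂ C  = ¬cluster (cluster-∞ {fin (suc K)} {H} C)

open P3Obstruction

lemma5 : (k : ℕ) → 1 ≤ k → (G : Graph) → HasP3Component G →
    (CographMinObs ∞ (fin k) G ⇔
      Σ Graph λ H → Cograph H × (G ≅ (P3 ⊕ H))
        × ¬ Polar (fin 1) (fin (k ∸ 1)) H
        × ¬ IsCluster ∞ H
        × Polar ∞ (fin (k ∸ 1)) H
        × (Polar (fin 1) (fin k) H ⊎ (2 ≤ k × Polar ∞ (fin (k ∸ 2)) H))
        × (∀ v → Polar (fin 1) (fin (k ∸ 1)) (H ─ v) ⊎ IsCluster (fin k) (H ─ v)))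
lemma5 (suc K) (s≤s z≤n) G P3-component = mk⇔ forward backward
  where
  forward : CographMinObs ∞ (fin (suc K)) G →
    Σ Graph λ H → Cograph H × (G ≅ (P3 ⊕ H)) × P3ObstructionConditions (suc K) H
  forward obstruction with P3-component-split P3-component
  ... | H , G≅P3⊕H with obstruction⇒conditions (cographMinObs-≅ (≅-sym G≅P3⊕H) obstruction)
  ...   | cograph , conditions = H , cograph , G≅P3⊕H , conditions

  backward : (Σ Graph λ H → Cograph H × (G ≅ (P3 ⊕ H)) × P3ObstructionConditions (suc K) H) →
    CographMinObs ∞ (fin (suc K)) G
  backward (H , cograph , G≅P3⊕H , conditions) =
    cographMinObs-≅ G≅P3⊕H (conditions⇒obstruction cograph conditions)
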